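{- For any positive integer $s$ let $h_s(x)=x/(1-x)^s$. Then for every $y\in\mathbb{K}[[x]]$, $$\mathcal{D}_{h_s}(y)=\sum_{k=0}^{s-1}\binom{s-1}{k}\frac{x^k}{k!}\big(\mathcal{D}_0(y)\big)^{(k)},$$ where $(\mathcal{D}_0(y))^{(k)}$ is the usual $k$-th derivative of the formal power series $\mathcal{D}_0(y)$.
   Context: $\mathbb{K}$ is a field of characteristic zero. For $h(x)=\sum_{k\ge1}h_kx^k$ with all $h_k\ne0$, the $h$-derivative is $\mathcal{D}_h\big(\sum_{k\ge0}s_kx^k\big)=\sum_{k\ge1}h_ks_kx^{k-1}$. $\mathcal{D}_0$ denotes the $h$-derivative for $h=x/(1-x)$ (the $0$-Jackson derivative), i.e. $\mathcal{D}_0\big(\sum_k s_kx^k\big)=\sum_{k\ge1}s_kx^{k-1}$. The usual derivative of formal power series is $\big(\sum_k s_kx^k\big)'=\sum_{k\ge1}ks_kx^{k-1}$. -}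

module Defs where

open import Level using (Level; _⊔_) renaming (suc to lsuc)
open import Algebra.Bundles using (CommutativeRing)
open import Relation.Nullary using (¬_; yes; no)
open import Data.Nat as ℕ using (ℕ; zero; suc; _∸_)
open import Data.Nat.Combinatorics using (_C_)
open import Function using (_∘_)

-- The inverse map is total (its value at 0
-- is irrelevant); only its behaviour on nonzero elements is specified.
record Field (c ℓ : Level) : Set (lsuc (c ⊔ ℓ)) where
  field
    commutativeRing : CommutativeRing c ℓ
  open CommutativeRing commutativeRing public
  field
    0≉1    : ¬ (0# ≈ 1#)
    _⁻¹    : Carrier → Carrier
    ⁻¹-inv : ∀ x → ¬ (x ≈ 0#) → x * (x ⁻¹) ≈ 1#

module FieldOps {c ℓ : Level} (K : Field c ℓ) where
  open Field K

  ι : ℕ → Carrier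
  ι zero    = 0#
  ι (suc n) = 1# + ι n

CharZero : {c ℓ : Level} → Field c ℓ → Set ℓ
CharZero K = ∀ n → ¬ (ι (suc n) ≈ 0#)
  where open Field K
        open FieldOps K

module PowerSeries {c ℓ : Level} (K : Field c ℓ) where
  open Field K
  open FieldOps K public

  PS : Set c
  PS = ℕ → Carrier

  infix 4 _≈ₚ_
  infixl 6 _+ₚ_
  infixl 7 _*ₚ_ _·ₚ_
  infixr 8 _^ₚ_
  _≈ₚ_ : PS → PS → Set ℓ
  f ≈ₚ g = ∀ n → f n ≈ g n

  sumK : ℕ → (ℕ → Carrier) → Carrier
  sumK zero    a = 0#
  sumK (suc n) a = sumK n a + a n

  sumPS : ℕ → (ℕ → PS) → PS
  sumPS n F m = sumK n (λ k → F k m)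

  _+ₚ_ : PS → PS → PS
  (f +ₚ g) n = f n + g n

  -ₚ_ : PS → PS
  (-ₚ f) n = - (f n)

  _·ₚ_ : Carrier → PS → PS
  (a ·ₚ f) n = a * f n

  _*ₚ_ : PS → PS → PS
  (f *ₚ g) n = sumK (suc n) (λ i → f i * g (n ∸ i))

  X^ : ℕ → PS
  X^ k n with k ℕ.≟ n
  ... | yes _ = 1#
  ... | no  _ = 0#

  oneₚ : PS
  oneₚ = X^ 0

  X : PS
  X = X^ 1

  _^ₚ_ : PS → ℕ → PS
  f ^ₚ zero    = oneₚ
  f ^ₚ (suc n) = f *ₚ (f ^ₚ n)

  D[_] : PS → PS → PS
  D[ h ] y n = h (suc n) * y (suc n)

  D₀ : PS → PS
  D₀ y n = y (suc n)

  deriv : PS → PS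
  deriv y n = ι (suc n) * y (suc n)

  deriv^ : ℕ → PS → PS
  deriv^ zero    y = y
  deriv^ (suc k) y = deriv (deriv^ k y)

{-# OPTIONS --safe #-}
module Submission where

open import Defs
open import Data.Nat using (ℕ; _≤_; _∸_)
open import Data.Nat using (_!)
open import Data.Nat.Combinatorics using (_C_)

open import Data.Nat as ℕ using (zero; suc; s≤s; z≤n; _<_; NonZero)
import Data.Nat.Properties as ℕₚ
open import Data.Nat.Combinatorics using (nC1≡n; nCn≡1; k>n⇒nCk≡0; nCk+nC[k+1]≡[n+1]C[k+1])
open import Data.Sum using (inj₁; inj₂)
open import Relation.Nullary using (¬_; yes; no; contradiction)
open import Relation.Binary.PropositionalEquality as ≡ using (_≡_; _≢_)
import Relation.Binary.Reasoning.Setoid as SetoidReasoning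

-- Multiplication by 1 - x is the backward difference Δ, so (1 - x)^s h = x says that the s-th
-- difference of h is x, which forces h = x/(1 - x)^s, i.e. h_{n+1} = C(s-1+n, s-1).  On the
-- other side, x^k f^(k) has n-th coefficient k! C(n,k) f_n, so the n-th coefficient of the
-- right-hand side is  Σ_k C(s-1,k) C(n,k) y_{n+1} = C(s-1+n, s-1) y_{n+1}  by Vandermonde.

module BinomialSums where
  open import Data.Nat using (_+_; _*_)
  open import Data.Nat.Properties
    using (+-identityʳ; *-identityˡ; *-identityʳ; +-assoc; +-comm; +-suc; *-comm; *-assoc; *-zeroʳ;
           *-distribˡ-+; *-distribʳ-+; n<1+n; +-commutativeSemigroup; *-commutativeSemigroup)
  open import Algebra.Properties.CommutativeSemigroup +-commutativeSemigroup using (x∙yz≈xz∙y; interchange)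
  open import Algebra.Properties.CommutativeSemigroup *-commutativeSemigroup using (xy∙z≈y∙xz)
  open import Relation.Binary.PropositionalEquality
    using (_≡_; refl; sym; trans; cong; cong₂; module ≡-Reasoning)

  [k+1]*[n+1]C[k+1]≡[n+1]*nCk : ∀ n k → suc k * (suc n C suc k) ≡ suc n * (n C k)
  [k+1]*[n+1]C[k+1]≡[n+1]*nCk zero    zero    = refl
  [k+1]*[n+1]C[k+1]≡[n+1]*nCk zero    (suc k) = *-zeroʳ (suc (suc k))
  [k+1]*[n+1]C[k+1]≡[n+1]*nCk (suc n) zero    =
    trans (*-identityˡ (suc (suc n) C 1)) (trans (nC1≡n (suc (suc n))) (sym (*-identityʳ (suc (suc n)))))
  [k+1]*[n+1]C[k+1]≡[n+1]*nCk (suc n) (suc k) = begin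
    suc (suc k) * (suc (suc n) C suc (suc k))
      ≡⟨ cong (suc (suc k) *_) (nCk+nC[k+1]≡[n+1]C[k+1] (suc n) (suc k)) ⟨
    suc (suc k) * (a + b)
      ≡⟨ *-distribˡ-+ (suc (suc k)) a b ⟩
    a + suc k * a + suc (suc k) * b
      ≡⟨ cong₂ (λ u v → a + u + v) ([k+1]*[n+1]C[k+1]≡[n+1]*nCk n k) ([k+1]*[n+1]C[k+1]≡[n+1]*nCk n (suc k)) ⟩
    a + suc n * (n C k) + suc n * (n C suc k)
      ≡⟨ +-assoc a (suc n * (n C k)) (suc n * (n C suc k)) ⟩
    a + (suc n * (n C k) + suc n * (n C suc k))
      ≡⟨ cong (a +_) (*-distribˡ-+ (suc n) (n C k) (n C suc k)) ⟨
    a + suc n * (n C k + n C suc k)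
      ≡⟨ cong (λ c → a + suc n * c) (nCk+nC[k+1]≡[n+1]C[k+1] n k) ⟩
    suc (suc n) * a
      ∎
    where
    open ≡-Reasoning
    a b : ℕ
    a = suc n C suc k
    b = suc n C suc (suc k)

  [k+1]!*[n+1]C[k+1]≡k!*nCk*[n+1] : ∀ n k → suc k ! * (suc n C suc k) ≡ k ! * (n C k) * suc n
  [k+1]!*[n+1]C[k+1]≡k!*nCk*[n+1] n k = begin
    suc k * k ! * (suc n C suc k)    ≡⟨ xy∙z≈y∙xz (suc k) (k !) (suc n C suc k) ⟩
    k ! * (suc k * (suc n C suc k))  ≡⟨ cong (k ! *_) ([k+1]*[n+1]C[k+1]≡[n+1]*nCk n k) ⟩
    k ! * (suc n * (n C k))          ≡⟨ cong (k ! *_) (*-comm (suc n) (n C k)) ⟩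
    k ! * ((n C k) * suc n)          ≡⟨ *-assoc (k !) (n C k) (suc n) ⟨
    k ! * (n C k) * suc n            ∎
    where open ≡-Reasoning

  sumℕ : ℕ → (ℕ → ℕ) → ℕ
  sumℕ zero    f = 0
  sumℕ (suc n) f = sumℕ n f + f n

  sumℕ-cong : ∀ n {f g : ℕ → ℕ} → (∀ i → f i ≡ g i) → sumℕ n f ≡ sumℕ n g
  sumℕ-cong zero    f≗g = refl
  sumℕ-cong (suc n) f≗g = cong₂ _+_ (sumℕ-cong n f≗g) (f≗g n)

  sumℕ-unrollˡ : ∀ n f → sumℕ (suc n) f ≡ f 0 + sumℕ n (λ i → f (suc i))
  sumℕ-unrollˡ zero    f = +-comm 0 (f 0)
  sumℕ-unrollˡ (suc n) f = trans (cong (_+ f (suc n)) (sumℕ-unrollˡ n f)) (+-assoc (f 0) _ _)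

  sumℕ-distrib-+ : ∀ n f g → sumℕ n (λ i → f i + g i) ≡ sumℕ n f + sumℕ n g
  sumℕ-distrib-+ zero    f g = refl
  sumℕ-distrib-+ (suc n) f g = trans (cong (_+ (f n + g n)) (sumℕ-distrib-+ n f g))
                                     (interchange (sumℕ n f) (sumℕ n g) (f n) (g n))

  -- The shift d is what lets the induction on r go through.
  vandermonde-shifted : ∀ r n d → sumℕ (suc r) (λ k → (r C k) * (n C (k + d))) ≡ (r + n) C (r + d)
  vandermonde-shifted zero    n d = +-identityʳ (n C d)
  vandermonde-shifted (suc r) n d = begin
    sumℕ (suc (suc r)) (λ k → (suc r C k) * (n C (k + d)))
      ≡⟨ sumℕ-unrollˡ (suc r) (λ k → (suc r C k) * (n C (k + d))) ⟩
    1 * (n C d) + sumℕ (suc r) (λ k → (suc r C suc k) * (n C (suc k + d)))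
      ≡⟨ cong₂ _+_ (*-identityˡ (n C d)) (sumℕ-cong (suc r) pascal) ⟩
    n C d + sumℕ (suc r) (λ k → f′ k + f (suc k))
      ≡⟨ cong (n C d +_) (sumℕ-distrib-+ (suc r) f′ (λ k → f (suc k))) ⟩
    n C d + (sumℕ (suc r) f′ + sumℕ (suc r) (λ k → f (suc k)))
      ≡⟨ x∙yz≈xz∙y (n C d) (sumℕ (suc r) f′) (sumℕ (suc r) (λ k → f (suc k))) ⟩
    (n C d + sumℕ (suc r) (λ k → f (suc k))) + sumℕ (suc r) f′
      ≡⟨ cong₂ _+_ unshifted shifted ⟩
    (r + n) C (r + d) + (r + n) C suc (r + d)
      ≡⟨ nCk+nC[k+1]≡[n+1]C[k+1] (r + n) (r + d) ⟩
    suc (r + n) C suc (r + d)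
      ∎
    where
    open ≡-Reasoning
    f f′ : ℕ → ℕ
    f  k = (r C k) * (n C (k + d))
    f′ k = (r C k) * (n C (k + suc d))
    pascal : ∀ k → (suc r C suc k) * (n C (suc k + d)) ≡ f′ k + f (suc k)
    pascal k = begin
      (suc r C suc k) * (n C (suc k + d))
        ≡⟨ cong (_* (n C (suc k + d))) (nCk+nC[k+1]≡[n+1]C[k+1] r k) ⟨
      (r C k + r C suc k) * (n C (suc k + d))
        ≡⟨ *-distribʳ-+ (n C (suc k + d)) (r C k) (r C suc k) ⟩
      (r C k) * (n C (suc k + d)) + f (suc k)
        ≡⟨ cong (λ j → (r C k) * (n C j) + f (suc k)) (+-suc k d) ⟨
      f′ k + f (suc k)
        ∎
    shifted : sumℕ (suc r) f′ ≡ (r + n) C suc (r + d)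
    shifted = trans (vandermonde-shifted r n (suc d)) (cong ((r + n) C_) (+-suc r d))
    unshifted : n C d + sumℕ (suc r) (λ k → f (suc k)) ≡ (r + n) C (r + d)
    unshifted = begin
      n C d + sumℕ (suc r) (λ k → f (suc k))
        ≡⟨ cong (_+ sumℕ (suc r) (λ k → f (suc k))) (*-identityˡ (n C d)) ⟨
      f 0 + sumℕ (suc r) (λ k → f (suc k))
        ≡⟨ sumℕ-unrollˡ (suc r) f ⟨
      sumℕ (suc r) f + (r C suc r) * (n C (suc r + d))
        ≡⟨ cong (λ c → sumℕ (suc r) f + c * (n C (suc r + d))) (k>n⇒nCk≡0 (n<1+n r)) ⟩
      sumℕ (suc r) f + 0
        ≡⟨ +-identityʳ (sumℕ (suc r) f) ⟩
      sumℕ (suc r) f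
        ≡⟨ vandermonde-shifted r n d ⟩
      (r + n) C (r + d)
        ∎

  vandermonde : ∀ r n → sumℕ (suc r) (λ k → (r C k) * (n C k)) ≡ (r + n) C r
  vandermonde r n = begin
    sumℕ (suc r) (λ k → (r C k) * (n C k))
      ≡⟨ sumℕ-cong (suc r) (λ k → cong (λ j → (r C k) * (n C j)) (+-identityʳ k)) ⟨
    sumℕ (suc r) (λ k → (r C k) * (n C (k + 0)))
      ≡⟨ vandermonde-shifted r n 0 ⟩
    (r + n) C (r + 0)
      ≡⟨ cong ((r + n) C_) (+-identityʳ r) ⟩
    (r + n) C r
      ∎
    where open ≡-Reasoning

open BinomialSums using (sumℕ; [k+1]!*[n+1]C[k+1]≡k!*nCk*[n+1]; vandermonde)

module PowerSeriesProperties {c ℓ} (K : Field c ℓ) where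
  open Field K hiding (zero)
  open PowerSeries K
  open import Algebra.Properties.Ring ring
    using (-0#≈0#; -1*x≈-x; -‿+-comm; [y-z]x≈yx-zx; //-rightDividesˡ; //-rightDividesʳ)
  open import Algebra.Properties.CommutativeSemigroup +-commutativeSemigroup using (interchange)
  open import Algebra.Properties.CommutativeSemigroup *-commutativeSemigroup using ()
    renaming (interchange to *-interchange)
  open SetoidReasoning setoid

  ι-homo-+ : ∀ m n → ι (m ℕ.+ n) ≈ ι m + ι n
  ι-homo-+ zero    n = sym (+-identityˡ (ι n))
  ι-homo-+ (suc m) n = trans (+-congˡ (ι-homo-+ m n)) (sym (+-assoc 1# (ι m) (ι n)))

  ι-homo-* : ∀ m n → ι (m ℕ.* n) ≈ ι m * ι n
  ι-homo-* zero    n = sym (zeroˡ (ι n))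
  ι-homo-* (suc m) n = begin
    ι (n ℕ.+ m ℕ.* n)     ≈⟨ ι-homo-+ n (m ℕ.* n) ⟩
    ι n + ι (m ℕ.* n)     ≈⟨ +-cong (sym (*-identityˡ (ι n))) (ι-homo-* m n) ⟩
    1# * ι n + ι m * ι n  ≈⟨ distribʳ (ι n) 1# (ι m) ⟨
    (1# + ι m) * ι n      ∎

  ι*[ι*x]≈ι[*]*x : ∀ m n x → ι m * (ι n * x) ≈ ι (m ℕ.* n) * x
  ι*[ι*x]≈ι[*]*x m n x = trans (sym (*-assoc (ι m) (ι n) x)) (*-congʳ (sym (ι-homo-* m n)))

  ι≉0 : CharZero K → ∀ n → .{{NonZero n}} → ¬ ι n ≈ 0#
  ι≉0 char0 (suc n) = char0 n

  x*y⁻¹*[y*z]≈x*z : ∀ x {y} z → ¬ y ≈ 0# → (x * y ⁻¹) * (y * z) ≈ x * z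
  x*y⁻¹*[y*z]≈x*z x {y} z y≉0 = begin
    (x * y ⁻¹) * (y * z)  ≈⟨ *-congˡ (*-comm y z) ⟩
    (x * y ⁻¹) * (z * y)  ≈⟨ *-interchange x (y ⁻¹) z y ⟩
    (x * z) * (y ⁻¹ * y)  ≈⟨ *-congˡ (trans (*-comm (y ⁻¹) y) (⁻¹-inv y y≉0)) ⟩
    (x * z) * 1#          ≈⟨ *-identityʳ (x * z) ⟩
    x * z                 ∎

  sumK-cong : ∀ n {f g : ℕ → Carrier} → (∀ i → f i ≈ g i) → sumK n f ≈ sumK n g
  sumK-cong zero    f≈g = refl
  sumK-cong (suc n) f≈g = +-cong (sumK-cong n f≈g) (f≈g n)

  sumK-unrollˡ : ∀ n f → sumK (suc n) f ≈ f 0 + sumK n (λ i → f (suc i))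
  sumK-unrollˡ zero    f = +-comm 0# (f 0)
  sumK-unrollˡ (suc n) f = trans (+-congʳ (sumK-unrollˡ n f)) (+-assoc (f 0) _ _)

  sumK-≈0 : ∀ n f → (∀ i → f i ≈ 0#) → sumK n f ≈ 0#
  sumK-≈0 zero    f f≈0 = refl
  sumK-≈0 (suc n) f f≈0 = trans (+-cong (sumK-≈0 n f f≈0) (f≈0 n)) (+-identityˡ 0#)

  sumK-distrib-diff : ∀ n f g → sumK n (λ i → f i - g i) ≈ sumK n f - sumK n g
  sumK-distrib-diff zero    f g = sym (trans (+-congˡ -0#≈0#) (+-identityʳ 0#))
  sumK-distrib-diff (suc n) f g = begin
    sumK n (λ i → f i - g i) + (f n - g n)   ≈⟨ +-congʳ (sumK-distrib-diff n f g) ⟩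
    (sumK n f - sumK n g) + (f n - g n)      ≈⟨ interchange (sumK n f) (- sumK n g) (f n) (- g n) ⟩
    (sumK n f + f n) + (- sumK n g + - g n)  ≈⟨ +-congˡ (-‿+-comm (sumK n g) (g n)) ⟩
    (sumK n f + f n) - (sumK n g + g n)      ∎

  sumK-ι* : ∀ n f x → sumK n (λ i → ι (f i) * x) ≈ ι (sumℕ n f) * x
  sumK-ι* zero    f x = sym (zeroˡ x)
  sumK-ι* (suc n) f x = begin
    sumK n (λ i → ι (f i) * x) + ι (f n) * x  ≈⟨ +-congʳ (sumK-ι* n f x) ⟩
    ι (sumℕ n f) * x + ι (f n) * x            ≈⟨ distribʳ x (ι (sumℕ n f)) (ι (f n)) ⟨
    (ι (sumℕ n f) + ι (f n)) * x              ≈⟨ *-congʳ (ι-homo-+ (sumℕ n f) (f n)) ⟨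
    ι (sumℕ n f ℕ.+ f n) * x                  ∎

  X^-diag : ∀ k → X^ k k ≈ 1#
  X^-diag k with k ℕ.≟ k
  ... | yes _   = refl
  ... | no  k≢k = contradiction ≡.refl k≢k

  X^-offdiag : ∀ {k i} → k ≢ i → X^ k i ≈ 0#
  X^-offdiag {k} {i} k≢i with k ℕ.≟ i
  ... | yes k≡i = contradiction k≡i k≢i
  ... | no  _   = refl

  sumK-X^*-≤ : ∀ {n k} (g : ℕ → Carrier) → n ≤ k → sumK n (λ i → X^ k i * g i) ≈ 0#
  sumK-X^*-≤ {zero}  g _   = refl
  sumK-X^*-≤ {suc n} {k} g n<k = begin
    sumK n (λ i → X^ k i * g i) + X^ k n * g n
      ≈⟨ +-cong (sumK-X^*-≤ g (ℕₚ.<⇒≤ n<k)) (*-congʳ (X^-offdiag (ℕₚ.>⇒≢ n<k))) ⟩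
    0# + 0# * g n  ≈⟨ +-identityˡ (0# * g n) ⟩
    0# * g n       ≈⟨ zeroˡ (g n) ⟩
    0#             ∎

  sumK-X^* : ∀ {n k} (g : ℕ → Carrier) → k < n → sumK n (λ i → X^ k i * g i) ≈ g k
  sumK-X^* {suc n} {k} g k<1+n with ℕₚ.m<1+n⇒m<n∨m≡n k<1+n
  ... | inj₁ k<n = begin
    sumK n (λ i → X^ k i * g i) + X^ k n * g n
      ≈⟨ +-cong (sumK-X^* g k<n) (*-congʳ (X^-offdiag (ℕₚ.<⇒≢ k<n))) ⟩
    g k + 0# * g n  ≈⟨ +-congˡ (zeroˡ (g n)) ⟩
    g k + 0#        ≈⟨ +-identityʳ (g k) ⟩
    g k             ∎
  ... | inj₂ ≡.refl = begin
    sumK k (λ i → X^ k i * g i) + X^ k k * g k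
      ≈⟨ +-cong (sumK-X^*-≤ {k} g ℕₚ.≤-refl) (*-congʳ (X^-diag k)) ⟩
    0# + 1# * g k  ≈⟨ +-identityˡ (1# * g k) ⟩
    1# * g k       ≈⟨ *-identityˡ (g k) ⟩
    g k            ∎

  X^*ₚ-≤ : ∀ {k n} (f : PS) → k ≤ n → (X^ k *ₚ f) n ≈ f (n ∸ k)
  X^*ₚ-≤ {n = n} f k≤n = sumK-X^* (λ i → f (n ∸ i)) (s≤s k≤n)

  X^*ₚ-> : ∀ {k n} (f : PS) → n < k → (X^ k *ₚ f) n ≈ 0#
  X^*ₚ-> {n = n} f n<k = sumK-X^*-≤ (λ i → f (n ∸ i)) n<k

  oneₚ*ₚ : ∀ (f : PS) → oneₚ *ₚ f ≈ₚ f
  oneₚ*ₚ f n = X^*ₚ-≤ f z≤n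

  *ₚ-congʳ : ∀ {f g} h → f ≈ₚ g → f *ₚ h ≈ₚ g *ₚ h
  *ₚ-congʳ h f≈g n = sumK-cong (suc n) (λ i → *-congʳ (f≈g i))

  Δ : PS → PS
  Δ f zero    = f zero
  Δ f (suc n) = f (suc n) - f n

  Δ-cong : ∀ {f g} → f ≈ₚ g → Δ f ≈ₚ Δ g
  Δ-cong f≈g zero    = f≈g zero
  Δ-cong f≈g (suc n) = +-cong (f≈g (suc n)) (-‿cong (f≈g n))

  Δ-injective : ∀ {f g} → Δ f ≈ₚ Δ g → f ≈ₚ g
  Δ-injective Δf≈Δg zero    = Δf≈Δg zero
  Δ-injective {f} {g} Δf≈Δg (suc n) = begin
    f (suc n)                ≈⟨ //-rightDividesˡ (f n) (f (suc n)) ⟨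
    (f (suc n) - f n) + f n  ≈⟨ +-cong (Δf≈Δg (suc n)) (Δ-injective Δf≈Δg n) ⟩
    (g (suc n) - g n) + g n  ≈⟨ //-rightDividesˡ (g n) (g (suc n)) ⟩
    g (suc n)                ∎

  Δ^ : ℕ → PS → PS
  Δ^ zero    f = f
  Δ^ (suc j) f = Δ (Δ^ j f)

  Δ^-suc : ∀ j f → Δ^ (suc j) f ≈ₚ Δ^ j (Δ f)
  Δ^-suc zero    f n = refl
  Δ^-suc (suc j) f   = Δ-cong (Δ^-suc j f)

  1-X : PS
  1-X = oneₚ +ₚ (-ₚ X)

  1-X[0]≈1 : 1-X 0 ≈ 1#
  1-X[0]≈1 = trans (+-congˡ -0#≈0#) (+-identityʳ 1#)

  1-X[1]≈-1 : 1-X 1 ≈ - 1#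
  1-X[1]≈-1 = +-identityˡ (- 1#)

  1-X[2+i]≈0 : ∀ i → 1-X (suc (suc i)) ≈ 0#
  1-X[2+i]≈0 i = trans (+-identityˡ (- 0#)) -0#≈0#

  1-X*ₚ≈Δ : ∀ f → 1-X *ₚ f ≈ₚ Δ f
  1-X*ₚ≈Δ f zero    = trans (+-identityˡ (1-X 0 * f 0)) (trans (*-congʳ 1-X[0]≈1) (*-identityˡ (f 0)))
  1-X*ₚ≈Δ f (suc m) = begin
    sumK (suc (suc m)) a
      ≈⟨ sumK-unrollˡ (suc m) a ⟩
    a 0 + sumK (suc m) (λ i → a (suc i))
      ≈⟨ +-congˡ (sumK-unrollˡ m (λ i → a (suc i))) ⟩
    a 0 + (a 1 + sumK m (λ i → a (suc (suc i))))
      ≈⟨ +-cong a₀ (+-cong a₁ (sumK-≈0 m (λ i → a (suc (suc i))) a₂₊)) ⟩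
    f (suc m) + (- f m + 0#)
      ≈⟨ +-congˡ (+-identityʳ (- f m)) ⟩
    f (suc m) - f m
      ∎
    where
    a : ℕ → Carrier
    a i = 1-X i * f (suc m ∸ i)
    a₀ : a 0 ≈ f (suc m)
    a₀ = trans (*-congʳ 1-X[0]≈1) (*-identityˡ (f (suc m)))
    a₁ : a 1 ≈ - f m
    a₁ = trans (*-congʳ 1-X[1]≈-1) (-1*x≈-x (f m))
    a₂₊ : ∀ i → a (suc (suc i)) ≈ 0#
    a₂₊ i = trans (*-congʳ (1-X[2+i]≈0 i)) (zeroˡ (f (m ∸ suc i)))

  Δ*ₚ≈Δ[*ₚ] : ∀ f g → Δ f *ₚ g ≈ₚ Δ (f *ₚ g)
  Δ*ₚ≈Δ[*ₚ] f g zero    = refl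
  Δ*ₚ≈Δ[*ₚ] f g (suc m) = begin
    sumK (suc (suc m)) (λ i → Δ f i * g (suc m ∸ i))
      ≈⟨ sumK-unrollˡ (suc m) (λ i → Δ f i * g (suc m ∸ i)) ⟩
    f 0 * g (suc m) + sumK (suc m) (λ i → (f (suc i) - f i) * g (m ∸ i))
      ≈⟨ +-congˡ (sumK-cong (suc m) (λ i → [y-z]x≈yx-zx (g (m ∸ i)) (f (suc i)) (f i))) ⟩
    f 0 * g (suc m) + sumK (suc m) (λ i → f (suc i) * g (m ∸ i) - f i * g (m ∸ i))
      ≈⟨ +-congˡ (sumK-distrib-diff (suc m) (λ i → f (suc i) * g (m ∸ i)) (λ i → f i * g (m ∸ i))) ⟩
    f 0 * g (suc m) + (sumK (suc m) (λ i → f (suc i) * g (m ∸ i)) - (f *ₚ g) m)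
      ≈⟨ +-assoc (f 0 * g (suc m)) (sumK (suc m) (λ i → f (suc i) * g (m ∸ i))) (- (f *ₚ g) m) ⟨
    (f 0 * g (suc m) + sumK (suc m) (λ i → f (suc i) * g (m ∸ i))) - (f *ₚ g) m
      ≈⟨ +-congʳ (sumK-unrollˡ (suc m) (λ i → f i * g (suc m ∸ i))) ⟨
    (f *ₚ g) (suc m) - (f *ₚ g) m
      ∎

  [1-X]^*ₚ≈Δ^ : ∀ j h → (1-X ^ₚ j) *ₚ h ≈ₚ Δ^ j h
  [1-X]^*ₚ≈Δ^ zero    h n = oneₚ*ₚ h n
  [1-X]^*ₚ≈Δ^ (suc j) h n = begin
    ((1-X *ₚ (1-X ^ₚ j)) *ₚ h) n  ≈⟨ *ₚ-congʳ h (1-X*ₚ≈Δ (1-X ^ₚ j)) n ⟩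
    (Δ (1-X ^ₚ j) *ₚ h) n         ≈⟨ Δ*ₚ≈Δ[*ₚ] (1-X ^ₚ j) h n ⟩
    Δ ((1-X ^ₚ j) *ₚ h) n         ≈⟨ Δ-cong ([1-X]^*ₚ≈Δ^ j h) n ⟩
    Δ (Δ^ j h) n                  ∎

  x/[1-x]^[1+_] : ℕ → PS
  x/[1-x]^[1+ t ] zero    = 0#
  x/[1-x]^[1+ t ] (suc n) = ι ((t ℕ.+ n) C t)

  Δ-x/[1-x]^[1+0] : Δ x/[1-x]^[1+ 0 ] ≈ₚ X
  Δ-x/[1-x]^[1+0] zero          = refl
  Δ-x/[1-x]^[1+0] (suc zero)    = trans (+-congˡ -0#≈0#) (trans (+-identityʳ (ι 1)) (+-identityʳ 1#))
  Δ-x/[1-x]^[1+0] (suc (suc n)) = -‿inverseʳ (ι 1)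

  Δ-x/[1-x]^[2+_] : ∀ t → Δ x/[1-x]^[1+ suc t ] ≈ₚ x/[1-x]^[1+ t ]
  Δ-x/[1-x]^[2+ t ] zero          = refl
  Δ-x/[1-x]^[2+ t ] (suc zero)    = begin
    ι ((suc t ℕ.+ 0) C suc t) - 0#  ≈⟨ trans (+-congˡ -0#≈0#) (+-identityʳ _) ⟩
    ι ((suc t ℕ.+ 0) C suc t)       ≡⟨ ≡.cong ι (≡.trans ([t+0]Ct≡1 (suc t)) (≡.sym ([t+0]Ct≡1 t))) ⟩
    ι ((t ℕ.+ 0) C t)               ∎
    where
    [t+0]Ct≡1 : ∀ t → (t ℕ.+ 0) C t ≡ 1
    [t+0]Ct≡1 t = ≡.trans (≡.cong (_C t) (ℕₚ.+-identityʳ t)) (nCn≡1 t)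
  Δ-x/[1-x]^[2+ t ] (suc (suc n)) = begin
    ι (suc (t ℕ.+ suc n) C suc t) - ι (suc (t ℕ.+ n) C suc t)
      ≡⟨ ≡.cong₂ (λ u v → ι u - ι v) (≡.sym (nCk+nC[k+1]≡[n+1]C[k+1] (t ℕ.+ suc n) t))
                                       (≡.cong (_C suc t) (≡.sym (ℕₚ.+-suc t n))) ⟩
    ι (a ℕ.+ b) - ι b    ≈⟨ +-congʳ (ι-homo-+ a b) ⟩
    (ι a + ι b) - ι b    ≈⟨ //-rightDividesʳ (ι b) (ι a) ⟩
    ι a                  ∎
    where
    a b : ℕ
    a = (t ℕ.+ suc n) C t
    b = (t ℕ.+ suc n) C suc t

  Δ^[1+t]≈X⇒≈x/[1-x]^[1+t] : ∀ t h → Δ^ (suc t) h ≈ₚ X → h ≈ₚ x/[1-x]^[1+ t ]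
  Δ^[1+t]≈X⇒≈x/[1-x]^[1+t] zero    h Δh≈X = Δ-injective λ n →
    trans (Δh≈X n) (sym (Δ-x/[1-x]^[1+0] n))
  Δ^[1+t]≈X⇒≈x/[1-x]^[1+t] (suc t) h Δ^h≈X = Δ-injective λ n →
    trans (Δh≈x/[1-x]^[1+t] n) (sym (Δ-x/[1-x]^[2+ t ] n))
    where
    Δh≈x/[1-x]^[1+t] : Δ h ≈ₚ x/[1-x]^[1+ t ]
    Δh≈x/[1-x]^[1+t] = Δ^[1+t]≈X⇒≈x/[1-x]^[1+t] t (Δ h) λ n →
      trans (sym (Δ^-suc (suc t) h n)) (Δ^h≈X n)

  deriv-cong : ∀ {f g} → f ≈ₚ g → deriv f ≈ₚ deriv g
  deriv-cong f≈g n = *-congˡ (f≈g (suc n))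

  deriv^-suc : ∀ k f → deriv^ (suc k) f ≈ₚ deriv^ k (deriv f)
  deriv^-suc zero    f n = refl
  deriv^-suc (suc k) f   = deriv-cong (deriv^-suc k f)

  deriv^-coefficient : ∀ k f m → deriv^ k f m ≈ ι (k ! ℕ.* ((k ℕ.+ m) C k)) * f (k ℕ.+ m)
  deriv^-coefficient zero    f m = sym (trans (*-congʳ (+-identityʳ 1#)) (*-identityˡ (f m)))
  deriv^-coefficient (suc k) f m = begin
    deriv^ (suc k) f m
      ≈⟨ deriv^-suc k f m ⟩
    deriv^ k (deriv f) m
      ≈⟨ deriv^-coefficient k (deriv f) m ⟩
    ι (k ! ℕ.* ((k ℕ.+ m) C k)) * (ι (suc (k ℕ.+ m)) * f (suc (k ℕ.+ m)))
      ≈⟨ ι*[ι*x]≈ι[*]*x (k ! ℕ.* ((k ℕ.+ m) C k)) (suc (k ℕ.+ m)) (f (suc (k ℕ.+ m))) ⟩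
    ι (k ! ℕ.* ((k ℕ.+ m) C k) ℕ.* suc (k ℕ.+ m)) * f (suc (k ℕ.+ m))
      ≡⟨ ≡.cong (λ c → ι c * f (suc (k ℕ.+ m))) ([k+1]!*[n+1]C[k+1]≡k!*nCk*[n+1] (k ℕ.+ m) k) ⟨
    ι (suc k ! ℕ.* (suc (k ℕ.+ m) C suc k)) * f (suc (k ℕ.+ m))
      ∎

  X^*ₚderiv^ : ∀ k f n → (X^ k *ₚ deriv^ k f) n ≈ ι (k ! ℕ.* (n C k)) * f n
  X^*ₚderiv^ k f n with ℕₚ.≤-<-connex k n
  ... | inj₁ k≤n = begin
    (X^ k *ₚ deriv^ k f) n                                ≈⟨ X^*ₚ-≤ (deriv^ k f) k≤n ⟩
    deriv^ k f (n ∸ k)                                    ≈⟨ deriv^-coefficient k f (n ∸ k) ⟩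
    ι (k ! ℕ.* ((k ℕ.+ (n ∸ k)) C k)) * f (k ℕ.+ (n ∸ k))
      ≡⟨ ≡.cong (λ j → ι (k ! ℕ.* (j C k)) * f j) (ℕₚ.m+[n∸m]≡n k≤n) ⟩
    ι (k ! ℕ.* (n C k)) * f n                             ∎
  ... | inj₂ n<k = begin
    (X^ k *ₚ deriv^ k f) n     ≈⟨ X^*ₚ-> (deriv^ k f) n<k ⟩
    0#                         ≈⟨ zeroˡ (f n) ⟨
    ι 0 * f n
      ≡⟨ ≡.cong (λ c → ι c * f n) (≡.trans (≡.cong (k ! ℕ.*_) (k>n⇒nCk≡0 n<k)) (ℕₚ.*-zeroʳ (k !))) ⟨
    ι (k ! ℕ.* (n C k)) * f n  ∎

  x/[1-x]^[1+t]-unique : ∀ t h → (1-X ^ₚ suc t) *ₚ h ≈ₚ X → h ≈ₚ x/[1-x]^[1+ t ]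
  x/[1-x]^[1+t]-unique t h [1-X]^[1+t]h≈X =
    Δ^[1+t]≈X⇒≈x/[1-x]^[1+t] t h (λ n → trans (sym ([1-X]^*ₚ≈Δ^ (suc t) h n)) ([1-X]^[1+t]h≈X n))

mainTheorem9 : ∀ {c ℓ} (K : Field c ℓ) → CharZero K →
    let open Field K
        open PowerSeries K
    in (s : ℕ) → 1 ≤ s →
       (h : PS) → ((oneₚ +ₚ (-ₚ X)) ^ₚ s) *ₚ h ≈ₚ X →
       (y : PS) →
       D[ h ] y ≈ₚ sumPS s (λ k →
         (ι ((s ∸ 1) C k) * (ι (k !) ⁻¹)) ·ₚ (X^ k *ₚ deriv^ k (D₀ y)))
mainTheorem9 K char0 (suc r) (s≤s z≤n) h hyp y n = begin
  h (suc n) * y (suc n)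
    ≈⟨ *-congʳ (x/[1-x]^[1+t]-unique r h hyp (suc n)) ⟩
  ι ((r ℕ.+ n) C r) * y (suc n)
    ≡⟨ ≡.cong (λ c → ι c * y (suc n)) (vandermonde r n) ⟨
  ι (sumℕ (suc r) (λ k → (r C k) ℕ.* (n C k))) * y (suc n)
    ≈⟨ sumK-ι* (suc r) (λ k → (r C k) ℕ.* (n C k)) (y (suc n)) ⟨
  sumK (suc r) (λ k → ι ((r C k) ℕ.* (n C k)) * y (suc n))
    ≈⟨ sumK-cong (suc r) term ⟨
  sumK (suc r) (λ k → (ι (r C k) * ι (k !) ⁻¹) * (X^ k *ₚ deriv^ k (D₀ y)) n)
    ∎
  where
  open Field K hiding (zero)
  open PowerSeries K
  open PowerSeriesProperties K
  open SetoidReasoning setoid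
  term : ∀ k → (ι (r C k) * ι (k !) ⁻¹) * (X^ k *ₚ deriv^ k (D₀ y)) n
               ≈ ι ((r C k) ℕ.* (n C k)) * y (suc n)
  term k = begin
    (ι (r C k) * ι (k !) ⁻¹) * (X^ k *ₚ deriv^ k (D₀ y)) n
      ≈⟨ *-congˡ (X^*ₚderiv^ k (D₀ y) n) ⟩
    (ι (r C k) * ι (k !) ⁻¹) * (ι (k ! ℕ.* (n C k)) * y (suc n))
      ≈⟨ *-congˡ (ι*[ι*x]≈ι[*]*x (k !) (n C k) (y (suc n))) ⟨
    (ι (r C k) * ι (k !) ⁻¹) * (ι (k !) * (ι (n C k) * y (suc n)))
      ≈⟨ x*y⁻¹*[y*z]≈x*z (ι (r C k)) (ι (n C k) * y (suc n)) (ι≉0 char0 (k !) {{ℕₚ._!≢0 k}}) ⟩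
    ι (r C k) * (ι (n C k) * y (suc n))
      ≈⟨ ι*[ι*x]≈ι[*]*x (r C k) (n C k) (y (suc n)) ⟩
    ι ((r C k) ℕ.* (n C k)) * y (suc n)
      ∎
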